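{- If a finite poset $P$ is a seed and avoids $(2+2)$, then $P$ is primitive.
   Context: Two incomparable elements $x,x'$ of a poset $P$ are exchangeable if for all $y\in P$: $x<y$ iff $x'<y$, and $x>y$ iff $x'>y$. A seed is a poset having no pair of exchangeable elements. A poset is primitive if it has no nontrivial automorphism. A poset $P$ contains $(2+2)$ if there are elements $a<b$ and $c<d$ in $P$ such that each of $a,b$ is incomparable with each of $c,d$; otherwise $P$ avoids $(2+2)$. -}

module Defs where

open import Data.Nat using (ℕ)
open import Data.Fin using (Fin)
open import Data.Product using (_×_; ∃-syntax)
open import Relation.Nullary using (¬_)
open import Relation.Binary.PropositionalEquality using (_≡_)
open import Relation.Binary.Structures using (IsStrictPartialOrder)
open import Function.Bundles using (_⇔_; _↔_; Inverse)

record FinPoset (n : ℕ) : Set₁ where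
  field
    _<_ : Fin n → Fin n → Set
    isStrictPartialOrder : IsStrictPartialOrder _≡_ _<_

  _>_ : Fin n → Fin n → Set
  x > y = y < x

  Incomparable : Fin n → Fin n → Set
  Incomparable x y = ¬ (x ≡ y) × ¬ (x < y) × ¬ (y < x)

  Exchangeable : Fin n → Fin n → Set
  Exchangeable x x' =
    Incomparable x x' ×
    (∀ y → ((x < y) ⇔ (x' < y)) × ((x > y) ⇔ (x' > y)))

  IsSeed : Set
  IsSeed = ∀ x x' → ¬ Exchangeable x x'

  Contains2+2 : Set
  Contains2+2 = ∃[ a ] ∃[ b ] ∃[ c ] ∃[ d ]
    (a < b) × (c < d) ×
    Incomparable a c × Incomparable a d ×
    Incomparable b c × Incomparable b d

  Avoids2+2 : Set
  Avoids2+2 = ¬ Contains2+2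

  record Automorphism : Set where
    field
      bij : Fin n ↔ Fin n
    open Inverse bij public using (to)
    field
      preserves : ∀ x y → (x < y) ⇔ (to x < to y)

  IsPrimitive : Set
  IsPrimitive = (φ : Automorphism) → ∀ x → Automorphism.to φ x ≡ x

-- In a (2+2)-free poset any two strict down-sets are comparable under inclusion: if a < x,
-- a ≮ y, c < y and c ≮ x, then a < x and c < y form a 2+2. An automorphism φ maps the
-- down-set of x onto that of φ x, so both have the same size; being comparable, they are
-- equal. Dually the up-sets agree, so x ≠ φ x would make x and φ x exchangeable.
-- Decidability of the order, needed for counting, holds under double negation, which
-- suffices because the goal φ x ≡ x is decidable.
module Submission where

open import Defs
open import Data.Nat as ℕ using (ℕ; zero; suc; z≤n)
import Data.Nat.Properties as ℕ
open import Data.Fin using (Fin; zero; suc)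
open import Data.Fin.Properties using (_≟_; all?; ¬∀⟶∃¬)
open import Data.Product using (_×_; _,_; ∃-syntax)
open import Data.Sum using (_⊎_; inj₁; inj₂)
open import Data.Empty using (⊥-elim)
open import Function.Base using (_∘_; flip)
open import Function.Bundles using (_⇔_; _↔_; Inverse; mk⇔; module Equivalence)
open import Function.Properties.Equivalence using () renaming (sym to ⇔-sym)
open import Level using (Level; 0ℓ)
open import Relation.Binary.Definitions using () renaming (Decidable to Decidable₂)
open import Relation.Binary.PropositionalEquality using (_≡_; refl; sym; trans)
open import Relation.Binary.Structures using (IsStrictPartialOrder)
import Relation.Binary.Construct.Flip.EqAndOrd as Flip
open import Relation.Nullary using (¬_; Dec; yes; no)
open import Relation.Nullary.Decidable using (decidable-stable; _→-dec_; ¬¬-excluded-middle)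
open import Relation.Nullary.Negation using (¬¬-map)
open import Relation.Unary using (Pred; _⊆_; _≐_; Decidable)
open import Algebra.Properties.CommutativeMonoid.Sum ℕ.+-0-commutativeMonoid
  using (sum; sum-permute; sum-cong-≗)

private
  variable
    a b ℓ : Level
    A B : Set a
    n : ℕ

¬¬-∀-Fin : {P : Pred (Fin n) ℓ} → (∀ i → ¬ ¬ P i) → ¬ ¬ (∀ i → P i)
¬¬-∀-Fin {zero}  _    k = k (λ ())
¬¬-∀-Fin {suc n} ¬¬P k = ¬¬P zero λ P₀ → ¬¬-∀-Fin (¬¬P ∘ suc) λ P₊ →
  k λ { zero → P₀ ; (suc i) → P₊ i }

¬¬-decidable₂ : {R : Fin n → Fin n → Set ℓ} → ¬ ¬ Decidable₂ R
¬¬-decidable₂ = ¬¬-∀-Fin λ i → ¬¬-∀-Fin λ j → ¬¬-excluded-middle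

indicator : Dec A → ℕ
indicator (yes _) = 1
indicator (no _)  = 0

indicator-mono : (A → B) → (a? : Dec A) (b? : Dec B) → indicator a? ℕ.≤ indicator b?
indicator-mono f (yes a) (yes _) = ℕ.≤-refl
indicator-mono f (yes a) (no ¬b) = ⊥-elim (¬b (f a))
indicator-mono f (no _)  _       = z≤n

indicator-< : ¬ A → B → (a? : Dec A) (b? : Dec B) → indicator a? ℕ.< indicator b?
indicator-< ¬a b (yes a) _       = ⊥-elim (¬a a)
indicator-< ¬a b (no _)  (yes _) = ℕ.≤-refl
indicator-< ¬a b (no _)  (no ¬b) = ⊥-elim (¬b b)

indicator-cong : A ⇔ B → (a? : Dec A) (b? : Dec B) → indicator a? ≡ indicator b?
indicator-cong A⇔B (yes _) (yes _) = refl
indicator-cong A⇔B (yes a) (no ¬b) = ⊥-elim (¬b (Equivalence.to A⇔B a))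
indicator-cong A⇔B (no ¬a) (yes b) = ⊥-elim (¬a (Equivalence.from A⇔B b))
indicator-cong A⇔B (no _)  (no _)  = refl

sum-mono-≤ : (f g : Fin n → ℕ) → (∀ i → f i ℕ.≤ g i) → sum f ℕ.≤ sum g
sum-mono-≤ {zero}  f g f≤g = z≤n
sum-mono-≤ {suc n} f g f≤g =
  ℕ.+-mono-≤ (f≤g zero) (sum-mono-≤ (f ∘ suc) (g ∘ suc) (f≤g ∘ suc))

sum-mono-< : (f g : Fin n → ℕ) → (∀ i → f i ℕ.≤ g i) → ∀ j → f j ℕ.< g j → sum f ℕ.< sum g
sum-mono-< {suc n} f g f≤g zero    f<g =
  ℕ.+-mono-<-≤ f<g (sum-mono-≤ (f ∘ suc) (g ∘ suc) (f≤g ∘ suc))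
sum-mono-< {suc n} f g f≤g (suc j) f<g =
  ℕ.+-mono-≤-< (f≤g zero) (sum-mono-< (f ∘ suc) (g ∘ suc) (f≤g ∘ suc) j f<g)

count : {P : Pred (Fin n) ℓ} → Decidable P → ℕ
count P? = sum (indicator ∘ P?)

module _ {P : Pred (Fin n) a} {Q : Pred (Fin n) b} (P? : Decidable P) (Q? : Decidable Q) where

  count-≡⇒⊇ : P ⊆ Q → count P? ≡ count Q? → Q ⊆ P
  count-≡⇒⊇ P⊆Q same {i} Qi with P? i
  ... | yes Pi = Pi
  ... | no ¬Pi = ⊥-elim (ℕ.<-irrefl same (sum-mono-< _ _
        (λ j → indicator-mono P⊆Q (P? j) (Q? j)) i (indicator-< ¬Pi Qi (P? i) (Q? i))))

  count-permute : (π : Fin n ↔ Fin n) → (∀ i → P (Inverse.to π i) ⇔ Q i) → count P? ≡ count Q?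
  count-permute π P∘π⇔Q = trans (sum-permute (indicator ∘ P?) π)
    (sum-cong-≗ λ i → indicator-cong (P∘π⇔Q i) (P? (Inverse.to π i)) (Q? i))

module DownSets (P : FinPoset n) (_<?_ : Decidable₂ (FinPoset._<_ P)) where
  open FinPoset P
  open IsStrictPartialOrder isStrictPartialOrder using (irrefl) renaming (trans to <-trans)

  ↓ : Fin n → Pred (Fin n) 0ℓ
  ↓ x = _< x

  ∣↓_∣ : Fin n → ℕ
  ∣↓ x ∣ = count (_<? x)

  crossing⇒2+2 : ∀ {a x c y} → a < x → ¬ a < y → c < y → ¬ c < x → Contains2+2
  crossing⇒2+2 {a} {x} {c} {y} a<x a≮y c<y c≮x = a , x , c , y , a<x , c<y
    , ((λ { refl → c≮x a<x }) , (λ a<c → a≮y (<-trans a<c c<y)) , (λ c<a → c≮x (<-trans c<a a<x)))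
    , ((λ { refl → c≮x (<-trans c<y a<x) }) , a≮y , (λ y<a → c≮x (<-trans (<-trans c<y y<a) a<x)))
    , ((λ { refl → a≮y (<-trans a<x c<y) }) , (λ x<c → a≮y (<-trans (<-trans a<x x<c) c<y)) , c≮x)
    , ((λ { refl → a≮y a<x }) , (λ x<y → a≮y (<-trans a<x x<y)) , (λ y<x → c≮x (<-trans c<y y<x)))

  ⊈⇒witness : ∀ {x y} → ¬ (∀ a → a < x → a < y) → ∃[ a ] a < x × ¬ a < y
  ⊈⇒witness {x} {y} ↓x⊈↓y with ¬∀⟶∃¬ n _ (λ a → (a <? x) →-dec (a <? y)) ↓x⊈↓y
  ... | a , ¬[a<x→a<y] =
    a , decidable-stable (a <? x) (λ a≮x → ¬[a<x→a<y] (⊥-elim ∘ a≮x)) , (λ a<y → ¬[a<x→a<y] λ _ → a<y)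

  ↓-total : Avoids2+2 → ∀ x y → ↓ x ⊆ ↓ y ⊎ ↓ y ⊆ ↓ x
  ↓-total avoids x y with all? (λ a → (a <? x) →-dec (a <? y))
  ... | yes ↓x⊆↓y = inj₁ (↓x⊆↓y _)
  ... | no ↓x⊈↓y  = inj₂ λ {c} c<y → decidable-stable (c <? x) λ c≮x →
    let a , a<x , a≮y = ⊈⇒witness ↓x⊈↓y in avoids (crossing⇒2+2 a<x a≮y c<y c≮x)

  ∣↓∣-invariant : (φ : Automorphism) → ∀ x → ∣↓ Automorphism.to φ x ∣ ≡ ∣↓ x ∣
  ∣↓∣-invariant φ x = count-permute (_<? to x) (_<? x) bij λ a → ⇔-sym (preserves a x)
    where open Automorphism φ

  automorphism-preserves-↓ : Avoids2+2 → (φ : Automorphism) → ∀ x → ↓ x ≐ ↓ (Automorphism.to φ x)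
  automorphism-preserves-↓ avoids φ x with ↓-total avoids x (to x)
    where open Automorphism φ
  ... | inj₁ ↓x⊆↓φx = ↓x⊆↓φx , count-≡⇒⊇ (_<? x) (_<? _) ↓x⊆↓φx (sym (∣↓∣-invariant φ x))
  ... | inj₂ ↓φx⊆↓x = count-≡⇒⊇ (_<? _) (_<? x) ↓φx⊆↓x (∣↓∣-invariant φ x) , ↓φx⊆↓x

_ᵒᵖ : FinPoset n → FinPoset n
P ᵒᵖ = record
  { _<_                  = flip (FinPoset._<_ P)
  ; isStrictPartialOrder = Flip.isStrictPartialOrder (FinPoset.isStrictPartialOrder P)
  }

module _ (P : FinPoset n) where
  open FinPoset P
  open IsStrictPartialOrder isStrictPartialOrder using (irrefl)

  avoids2+2ᵒᵖ : Avoids2+2 → FinPoset.Avoids2+2 (P ᵒᵖ)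
  avoids2+2ᵒᵖ avoids (a , b , c , d , b<a , d<c , a∥c , a∥d , b∥c , b∥d) =
    avoids (b , a , d , c , b<a , d<c , unflip b∥d , unflip b∥c , unflip a∥d , unflip a∥c)
    where
    unflip : ∀ {x y} → FinPoset.Incomparable (P ᵒᵖ) x y → Incomparable x y
    unflip (x≢y , y≮x , x≮y) = x≢y , x≮y , y≮x

  automorphismᵒᵖ : Automorphism → FinPoset.Automorphism (P ᵒᵖ)
  automorphismᵒᵖ φ = record { bij = bij ; preserves = λ x y → preserves y x }
    where open Automorphism φ

  same-neighbourhoods⇒exchangeable : ∀ {x x'} → ¬ x ≡ x' →
    (_< x) ≐ (_< x') → (x <_) ≐ (x' <_) → Exchangeable x x'
  same-neighbourhoods⇒exchangeable x≢x' (↓x⊆↓x' , ↓x'⊆↓x) (↑x⊆↑x' , ↑x'⊆↑x) =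
    (x≢x' , (λ x<x' → irrefl refl (↓x'⊆↓x x<x')) , (λ x'<x → irrefl refl (↓x⊆↓x' x'<x)))
    , λ y → mk⇔ ↑x⊆↑x' ↑x'⊆↑x , mk⇔ ↓x⊆↓x' ↓x'⊆↓x

  decidable⇒primitive : Decidable₂ _<_ → IsSeed → Avoids2+2 → IsPrimitive
  decidable⇒primitive _<?_ seed avoids φ x with to x ≟ x
    where open Automorphism φ
  ... | yes φx≡x = φx≡x
  ... | no  φx≢x = ⊥-elim (seed x (Automorphism.to φ x) (same-neighbourhoods⇒exchangeable (φx≢x ∘ sym)
      (Down.automorphism-preserves-↓ avoids φ x)
      (Up.automorphism-preserves-↓ (avoids2+2ᵒᵖ avoids) (automorphismᵒᵖ φ) x)))
    where
    module Down = DownSets P _<?_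
    module Up   = DownSets (P ᵒᵖ) (flip _<?_)

proposition4p2 : (n : ℕ) (P : FinPoset n) →
    FinPoset.IsSeed P → FinPoset.Avoids2+2 P → FinPoset.IsPrimitive P
proposition4p2 n P seed avoids φ x = decidable-stable (Automorphism.to φ x ≟ x)
  (¬¬-map (λ _<?_ → decidable⇒primitive P _<?_ seed avoids φ x) ¬¬-decidable₂)
  where open FinPoset P
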